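{- Let $G$ be a finite, simple, connected graph with $|V(G)| = n$ and vertex connectivity $\kappa(G)$, and let $k$ be an integer with $2 \leq k \leq n - \kappa(G)$. Then $T_k(G)$, together with $n$, uniquely determines $\kappa(G)$: for every finite, simple, connected graph $G'$ with $|V(G')| = n$ and $T_k(G') = T_k(G)$, we have $\kappa(G') = \kappa(G)$.
   Context: Graphs are finite, simple, connected and labeled. For $k \geq 2$ and a graph $G$, the set of connected $k$-sets is $T_k(G) = \{X \subseteq V(G) : |X| = k \text{ and the subgraph of } G \text{ induced by } X \text{ is connected}\}$. $\kappa(G)$ is the vertex connectivity of $G$. -}

module Defs where

open import Data.Nat using (ℕ; _≤_; _+_)
open import Data.Fin using (Fin)
open import Data.Bool using (Bool; true; false)
open import Data.Fin.Subset using (Subset; _∈_; ∁; ∣_∣; ⊤)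
open import Data.Product using (Σ; _×_; ∃)
open import Data.Sum using (_⊎_)
open import Relation.Nullary using (¬_)
open import Relation.Binary.PropositionalEquality using (_≡_)

record Graph (n : ℕ) : Set where
  field
    adj   : Fin n → Fin n → Bool
    sym   : ∀ u v → adj u v ≡ adj v u
    irref : ∀ u → adj u u ≡ false
open Graph public

data WalkIn {n : ℕ} (G : Graph n) (X : Subset n) : Fin n → Fin n → Set where
  here : ∀ {u} → u ∈ X → WalkIn G X u u
  step : ∀ {u w v} → u ∈ X → adj G u w ≡ true → WalkIn G X w v → WalkIn G X u v

InducedConnected : {n : ℕ} → Graph n → Subset n → Set
InducedConnected G X = ∀ u v → u ∈ X → v ∈ X → WalkIn G X u v

Connected : {n : ℕ} → Graph n → Set
Connected {n} G = (1 ≤ n) × InducedConnected G ⊤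

InT : {n : ℕ} → ℕ → Graph n → Subset n → Set
InT k G X = (∣ X ∣ ≡ k) × InducedConnected G X

Separating : {n : ℕ} → Graph n → Subset n → Set
Separating G S = (¬ InducedConnected G (∁ S)) ⊎ (∣ ∁ S ∣ ≤ 1)

IsVertexConnectivity : {n : ℕ} → Graph n → ℕ → Set
IsVertexConnectivity G c =
  (Σ _ λ S → (∣ S ∣ ≡ c) × Separating G S) × (∀ S → Separating G S → c ≤ ∣ S ∣)

-- An edge uw of G inside a connected vertex set Y with |Y| ≥ k can be grown, one
-- boundary vertex at a time, into a connected k-set X with {u, w} ⊆ X ⊆ Y. If X is
-- also connected in G′, then u and w are joined by a walk of G′ inside Y; hence
-- T_k(G) ⊆ T_k(G′) makes every connected set of G of size ≥ k connected in G′.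
-- A minimum vertex cut of G leaves n − κ(G) ≥ k vertices, so it also cuts G′ and
-- κ(G′) ≤ κ(G); then a minimum cut of G′ leaves n − κ(G′) ≥ k vertices and the same
-- argument with G and G′ swapped gives κ(G) ≤ κ(G′).
module Submission where

open import Defs
open import Data.Nat using (ℕ; zero; suc; _≤_; _<_; _+_; _∸_)
open import Data.Nat.Properties
  using (≤-trans; <⇒≤; <⇒≱; n≮n; +-suc; +-identityʳ; +-monoʳ-≤; ≤-antisym; m+[n∸m]≡n; m+n≤o⇒m≤o∸n)
open import Data.Fin using (Fin)
open import Data.Fin.Properties using (¬∀⟶∃¬)
open import Data.Fin.Subset using (Subset; _∈_; _∉_; ∁; ∣_∣; _∪_; ⁅_⁆; _⊆_; inside; outside)
open import Data.Fin.Subset.Properties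
  using (_∈?_; x∈p∪q⁻; p⊆p∪q; q⊆p∪q; x∈⁅x⁆; x∈⁅y⁆⇒x≡y; x≢y⇒x∉⁅y⁆; ∣⁅x⁆∣≡1; ∣∁p∣≡n∸∣p∣;
         ∪-identityʳ; p⊆q⇒∣p∣≤∣q∣)
open import Data.Vec using (_∷_; here; there)
open import Data.Product using (Σ-syntax; _×_; _,_; proj₁; proj₂)
open import Data.Sum using (inj₁; inj₂)
open import Data.Bool using (true)
open import Data.Empty using (⊥-elim)
open import Function using (_∘_)
open import Relation.Nullary using (¬_; yes; no)
open import Relation.Nullary.Decidable using (_→-dec_)
import Relation.Binary.PropositionalEquality as ≡
open ≡ using (_≡_; refl; subst; cong; trans)

∣p∪⁅x⁆∣≡1+∣p∣ : ∀ {n} (p : Subset n) {x} → x ∉ p → ∣ p ∪ ⁅ x ⁆ ∣ ≡ suc ∣ p ∣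
∣p∪⁅x⁆∣≡1+∣p∣ (inside  ∷ p) {Fin.zero}  x∉p = ⊥-elim (x∉p here)
∣p∪⁅x⁆∣≡1+∣p∣ (outside ∷ p) {Fin.zero}  x∉p = cong (suc ∘ ∣_∣) (∪-identityʳ p)
∣p∪⁅x⁆∣≡1+∣p∣ (inside  ∷ p) {Fin.suc x} x∉p = cong suc (∣p∪⁅x⁆∣≡1+∣p∣ p (x∉p ∘ there))
∣p∪⁅x⁆∣≡1+∣p∣ (outside ∷ p) {Fin.suc x} x∉p = ∣p∪⁅x⁆∣≡1+∣p∣ p (x∉p ∘ there)

p∪⁅x⁆⊆q : ∀ {n} {p q : Subset n} {x} → p ⊆ q → x ∈ q → p ∪ ⁅ x ⁆ ⊆ q
p∪⁅x⁆⊆q {p = p} {x = x} p⊆q x∈q y∈ with x∈p∪q⁻ p ⁅ x ⁆ y∈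
... | inj₁ y∈p = p⊆q y∈p
... | inj₂ y∈x rewrite x∈⁅y⁆⇒x≡y x y∈x = x∈q

∣q∣<∣p∣⇒∃∈p∖q : ∀ {n} {p q : Subset n} → ∣ q ∣ < ∣ p ∣ → Σ[ x ∈ Fin n ] x ∈ p × x ∉ q
∣q∣<∣p∣⇒∃∈p∖q {n} {p} {q} ∣q∣<∣p∣ with ¬∀⟶∃¬ n (λ x → x ∈ p → x ∈ q) (λ x → x ∈? p →-dec x ∈? q)
                                           (λ p⊆q → <⇒≱ ∣q∣<∣p∣ (p⊆q⇒∣p∣≤∣q∣ (p⊆q _)))
... | x , p⊈q with x ∈? p
...   | yes x∈p = x , x∈p , λ x∈q → p⊈q (λ _ → x∈q)
...   | no  x∉p = ⊥-elim (p⊈q (⊥-elim ∘ x∉p))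

BoundaryEdge : ∀ {n} → Graph n → Subset n → Subset n → Set
BoundaryEdge {n} G Z Y = Σ[ z ∈ Fin n ] Σ[ y ∈ Fin n ] z ∈ Z × y ∈ Y × y ∉ Z × adj G z y ≡ true

module _ {n : ℕ} {G : Graph n} where

  WalkIn-mono : ∀ {X Y u v} → X ⊆ Y → WalkIn G X u v → WalkIn G Y u v
  WalkIn-mono X⊆Y (here u∈X)         = here (X⊆Y u∈X)
  WalkIn-mono X⊆Y (step u∈X uw walk) = step (X⊆Y u∈X) uw (WalkIn-mono X⊆Y walk)

  _++ʷ_ : ∀ {X u v w} → WalkIn G X u v → WalkIn G X v w → WalkIn G X u w
  here _           ++ʷ walk′ = walk′
  step u∈X uw walk ++ʷ walk′ = step u∈X uw (walk ++ʷ walk′)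

  WalkIn-source∈ : ∀ {X u v} → WalkIn G X u v → u ∈ X
  WalkIn-source∈ (here u∈X)     = u∈X
  WalkIn-source∈ (step u∈X _ _) = u∈X

  WalkIn-exit : ∀ {Z Y a b} → WalkIn G Y a b → a ∈ Z → b ∉ Z → BoundaryEdge G Z Y
  WalkIn-exit (here _) a∈Z b∉Z = ⊥-elim (b∉Z a∈Z)
  WalkIn-exit {Z} {a = a} (step {w = w} _ aw walk) a∈Z b∉Z with w ∈? Z
  ... | yes w∈Z = WalkIn-exit walk w∈Z b∉Z
  ... | no  w∉Z = a , w , a∈Z , WalkIn-source∈ walk , w∉Z , aw

module _ {n : ℕ} (G : Graph n) where

  InducedConnected-⁅⁆ : ∀ u → InducedConnected G ⁅ u ⁆
  InducedConnected-⁅⁆ u a b a∈ b∈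
    rewrite x∈⁅y⁆⇒x≡y u a∈ | x∈⁅y⁆⇒x≡y u b∈ = here (x∈⁅x⁆ u)

  InducedConnected-∪⁅⁆ : ∀ {Z z y} → InducedConnected G Z → z ∈ Z → adj G z y ≡ true →
                         InducedConnected G (Z ∪ ⁅ y ⁆)
  InducedConnected-∪⁅⁆ {Z} {z} {y} conn z∈Z zy a b a∈ b∈
    with x∈p∪q⁻ Z ⁅ y ⁆ a∈ | x∈p∪q⁻ Z ⁅ y ⁆ b∈
  ... | inj₁ a∈Z | inj₁ b∈Z = WalkIn-mono Z⊆ (conn a b a∈Z b∈Z)
    where Z⊆ = p⊆p∪q {p = Z} ⁅ y ⁆
  ... | inj₁ a∈Z | inj₂ b∈y rewrite x∈⁅y⁆⇒x≡y y b∈y =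
    WalkIn-mono Z⊆ (conn a z a∈Z z∈Z) ++ʷ step (Z⊆ z∈Z) zy (here b∈)
    where Z⊆ = p⊆p∪q {p = Z} ⁅ y ⁆
  ... | inj₂ a∈y | inj₁ b∈Z rewrite x∈⁅y⁆⇒x≡y y a∈y =
    step a∈ (trans (sym G y z) zy) (WalkIn-mono (p⊆p∪q {p = Z} ⁅ y ⁆) (conn z b z∈Z b∈Z))
  ... | inj₂ a∈y | inj₂ b∈y rewrite x∈⁅y⁆⇒x≡y y a∈y | x∈⁅y⁆⇒x≡y y b∈y = here a∈

  ConnectedBetween : Subset n → Subset n → ℕ → Set
  ConnectedBetween Z Y m = Σ[ X ∈ Subset n ] Z ⊆ X × X ⊆ Y × InducedConnected G X × ∣ X ∣ ≡ m

  module _ {Y : Subset n} (connY : InducedConnected G Y) where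

    ConnectedBetween-suc : ∀ {Z z m} → z ∈ Z → m < ∣ Y ∣ →
                           ConnectedBetween Z Y m → ConnectedBetween Z Y (suc m)
    ConnectedBetween-suc {z = z} z∈Z m<∣Y∣ (X , Z⊆X , X⊆Y , connX , refl)
      with ∣q∣<∣p∣⇒∃∈p∖q m<∣Y∣
    ... | v , v∈Y , v∉X with WalkIn-exit (connY z v (X⊆Y (Z⊆X z∈Z)) v∈Y) (Z⊆X z∈Z) v∉X
    ...   | x , y , x∈X , y∈Y , y∉X , xy =
      X ∪ ⁅ y ⁆ , p⊆p∪q ⁅ y ⁆ ∘ Z⊆X , p∪⁅x⁆⊆q X⊆Y y∈Y ,
      InducedConnected-∪⁅⁆ connX x∈X xy , ∣p∪⁅x⁆∣≡1+∣p∣ X y∉X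

    connectedBetween : ∀ {Z z} → Z ⊆ Y → InducedConnected G Z → z ∈ Z →
                       ∀ d → ∣ Z ∣ + d ≤ ∣ Y ∣ → ConnectedBetween Z Y (∣ Z ∣ + d)
    connectedBetween {Z} Z⊆Y connZ z∈Z zero _ =
      Z , (λ x∈Z → x∈Z) , Z⊆Y , connZ , ≡.sym (+-identityʳ ∣ Z ∣)
    connectedBetween {Z} Z⊆Y connZ z∈Z (suc d) ∣Z∣+d<∣Y∣ rewrite +-suc ∣ Z ∣ d =
      ConnectedBetween-suc z∈Z ∣Z∣+d<∣Y∣ (connectedBetween Z⊆Y connZ z∈Z d (<⇒≤ ∣Z∣+d<∣Y∣))

    edge-in-Tₖ : ∀ {k u w} → 2 ≤ k → k ≤ ∣ Y ∣ → u ∈ Y → w ∈ Y → adj G u w ≡ true →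
                 Σ[ X ∈ Subset n ] InT k G X × X ⊆ Y × u ∈ X × w ∈ X
    edge-in-Tₖ {k} {u} {w} 2≤k k≤∣Y∣ u∈Y w∈Y uw =
      let (X , uw⊆X , X⊆Y , connX , ∣X∣≡) =
            connectedBetween uw⊆Y (InducedConnected-∪⁅⁆ (InducedConnected-⁅⁆ u) (x∈⁅x⁆ u) uw)
              u∈uw (k ∸ 2) (subst (_≤ ∣ Y ∣) (≡.sym ∣uw∣+k∸2≡k) k≤∣Y∣)
      in X , (trans ∣X∣≡ ∣uw∣+k∸2≡k , connX) , X⊆Y , uw⊆X u∈uw , uw⊆X (q⊆p∪q ⁅ u ⁆ ⁅ w ⁆ (x∈⁅x⁆ w))
      where
      u∈uw : u ∈ ⁅ u ⁆ ∪ ⁅ w ⁆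
      u∈uw = p⊆p∪q ⁅ w ⁆ (x∈⁅x⁆ u)
      uw⊆Y : ⁅ u ⁆ ∪ ⁅ w ⁆ ⊆ Y
      uw⊆Y = p∪⁅x⁆⊆q (λ x∈u → subst (_∈ Y) (≡.sym (x∈⁅y⁆⇒x≡y u x∈u)) u∈Y) w∈Y
      w≢u : ¬ w ≡ u
      w≢u refl with trans (≡.sym uw) (irref G u)
      ... | ()
      ∣uw∣+k∸2≡k : ∣ ⁅ u ⁆ ∪ ⁅ w ⁆ ∣ + (k ∸ 2) ≡ k
      ∣uw∣+k∸2≡k = begin
        ∣ ⁅ u ⁆ ∪ ⁅ w ⁆ ∣ + (k ∸ 2) ≡⟨ cong (_+ (k ∸ 2)) (∣p∪⁅x⁆∣≡1+∣p∣ ⁅ u ⁆ (x≢y⇒x∉⁅y⁆ w≢u)) ⟩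
        suc ∣ ⁅ u ⁆ ∣ + (k ∸ 2)     ≡⟨ cong (λ m → suc m + (k ∸ 2)) (∣⁅x⁆∣≡1 u) ⟩
        2 + (k ∸ 2)                 ≡⟨ m+[n∸m]≡n 2≤k ⟩
        k                           ∎
        where open ≡.≡-Reasoning

module _ {n k : ℕ} {G G′ : Graph n} (Tₖ⊆ : ∀ X → InT k G X → InT k G′ X) (2≤k : 2 ≤ k) where

  InducedConnected-transfer : ∀ {Y} → k ≤ ∣ Y ∣ → InducedConnected G Y → InducedConnected G′ Y
  InducedConnected-transfer {Y} k≤∣Y∣ connY a b a∈Y b∈Y = walk′ (connY a b a∈Y b∈Y)
    where
    walk′ : ∀ {a b} → WalkIn G Y a b → WalkIn G′ Y a b
    walk′ (here a∈Y)              = here a∈Y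
    walk′ (step {u} {w} u∈Y uw walk) =
      let (X , Tₖ∋X , X⊆Y , u∈X , w∈X) =
            edge-in-Tₖ G connY 2≤k k≤∣Y∣ u∈Y (WalkIn-source∈ walk) uw
      in WalkIn-mono X⊆Y (proj₂ (Tₖ⊆ X Tₖ∋X) u w u∈X w∈X) ++ʷ walk′ walk

  Separating-transfer : ∀ {S} → k ≤ ∣ ∁ S ∣ → Separating G′ S → Separating G S
  Separating-transfer k≤∣∁S∣ (inj₁ disconnected) =
    inj₁ (disconnected ∘ InducedConnected-transfer k≤∣∁S∣)
  Separating-transfer k≤∣∁S∣ (inj₂ ∣∁S∣≤1) = ⊥-elim (n≮n 1 (≤-trans 2≤k (≤-trans k≤∣∁S∣ ∣∁S∣≤1)))

  vertexConnectivity-≤ : ∀ {c c′} → k + c′ ≤ n → IsVertexConnectivity G′ c′ →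
                         (∀ S → Separating G S → c ≤ ∣ S ∣) → c ≤ c′
  vertexConnectivity-≤ {c} {c′} k+c′≤n ((S , ∣S∣≡c′ , sepS) , _) minimal =
    subst (c ≤_) ∣S∣≡c′ (minimal S (Separating-transfer k≤∣∁S∣ sepS))
    where
    k≤∣∁S∣ : k ≤ ∣ ∁ S ∣
    k≤∣∁S∣ = subst (k ≤_) (≡.sym (trans (∣∁p∣≡n∸∣p∣ S) (cong (n ∸_) ∣S∣≡c′))) (m+n≤o⇒m≤o∸n k k+c′≤n)

theorem2p2 : (n k c c' : ℕ) (G G' : Graph n) →
    Connected G → Connected G' →
    IsVertexConnectivity G c → IsVertexConnectivity G' c' →
    2 ≤ k → k + c ≤ n →
    ((X : Subset n) → (InT k G X → InT k G' X) × (InT k G' X → InT k G X)) →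
    c' ≡ c
theorem2p2 n k c c' G G' _ _ κG κG' 2≤k k+c≤n Tₖ≡ = ≤-antisym c'≤c c≤c'
  where
  c'≤c : c' ≤ c
  c'≤c = vertexConnectivity-≤ (proj₂ ∘ Tₖ≡) 2≤k k+c≤n κG (proj₂ κG')
  c≤c' : c ≤ c'
  c≤c' = vertexConnectivity-≤ (proj₁ ∘ Tₖ≡) 2≤k (≤-trans (+-monoʳ-≤ k c'≤c) k+c≤n) κG' (proj₂ κG)
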